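{- Let $\Pi([N])=\{\prod_{t\in T}t: T\subseteq[N]\}$. Then $$|\mathbf{V}_{\mathrm{small}}(\Pi([N]))|\le \exp(O(N^{1/3+o(1)})),$$ i.e. for every $\varepsilon>0$ there is $C_\varepsilon$ with $|\mathbf{V}_{\mathrm{small}}(\Pi([N]))|\le\exp(C_\varepsilon N^{1/3+\varepsilon})$ for all $N$.
   Context: Fix $N$. $\mathcal{P}_{\mathrm{small}}$ is the set of primes in $[1,N^{1/3}]$. For a prime $p$ and $n\in\mathbb{N}$, $V_p(n)$ is the exponent of $p$ in $n$. $\mathbf{V}_{\mathrm{small}}:\mathbb{N}\to\mathbb{Z}^{\mathcal{P}_{\mathrm{small}}}$ is $\mathbf{V}_{\mathrm{small}}(n)=(V_p(n))_{p\in\mathcal{P}_{\mathrm{small}}}$. -}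

module Defs where

open import Data.Nat using (ℕ; zero; suc; _*_; _^_; _≤_)
open import Data.Nat.Divisibility using (_∣_)
open import Data.Nat.Primality using (Prime)
open import Data.Bool using (true; false)
open import Data.Vec using (_∷_; [])
open import Data.Fin.Subset using (Subset)
open import Data.Product using (_×_)
open import Relation.Nullary using (¬_)

-- A subset T ⊆ [N] is a 'Subset N'
-- (a 'Vec Bool N'); in a vector of length suc n the head records
-- whether the element (suc n) belongs to T, the tail is a subset of [n].
-- prodSubset T = ∏_{t ∈ T} t  (empty product = 1).
prodSubset : ∀ {n} → Subset n → ℕ
prodSubset {zero}  []           = 1
prodSubset {suc n} (true  ∷ s) = suc n * prodSubset s
prodSubset {suc n} (false ∷ s) = prodSubset s

SmallPrime : ℕ → ℕ → Set
SmallPrime N p = Prime p × (p ^ 3 ≤ N)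

-- v agrees with V_small(m) on the small primes:
-- for each small prime p, v p = V_p(m), the exponent of p in m
-- (p^(v p) ∣ m and p^(v p + 1) ∤ m).
IsVsmall : ℕ → ℕ → (ℕ → ℕ) → Set
IsVsmall N m v = ∀ p → SmallPrime N p → (p ^ v p ∣ m) × ¬ (p ^ suc (v p) ∣ m)

module Submission where

open import Defs
open import Data.Nat using (ℕ; zero; suc; _+_; _*_; _^_; _≤_; _<_; z≤n; s≤s; NonZero; >-nonZero⁻¹; _≤?_)
open import Data.Nat.Properties
open import Data.Nat.Divisibility using (_∣_; _∣?_; ∣⇒≤; 1∣_)
open import Data.Nat.Primality using (Prime; ¬prime[0]; ¬prime[1]; prime⇒nonZero)
open import Data.List using (List; []; _∷_; length; map; _++_; cartesianProductWith; upTo)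
open import Data.List.Properties using (length-map; length-++; length-upTo)
open import Data.List.Membership.Propositional using (_∈_)
open import Data.List.Membership.Propositional.Properties using (∈-cartesianProductWith⁺; ∈-upTo⁺)
open import Data.List.Relation.Unary.Any using (here)
open import Data.Fin.Subset using (Subset)
open import Data.Bool using (true; false)
open import Data.Vec using ([]; _∷_)
open import Data.Product using (Σ; ∃-syntax; _×_; _,_; proj₁; proj₂)
open import Data.Sum using (_⊎_; inj₁; inj₂)
open import Function using (_∘_; const)
open import Relation.Nullary using (¬_; ¬?; yes; no; contradiction)
open import Relation.Nullary.Decidable using (decidable-stable)
open import Relation.Unary using (Pred; Decidable)
open import Relation.Binary.PropositionalEquality using (_≡_; refl; sym; trans; cong; cong₂; module ≡-Reasoning)
open import Data.Nat.Solver using (module +-*-Solver)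
open +-*-Solver

-- Each subset product m = ∏T is at most N^N, so when N ≤ 2^t every exponent V_p(m) is at
-- most tN, and if N ≤ b³ every small prime is below b + 1.  Thus V_small(Π([N])) lies in a
-- box of (tN + 1)^(b+1) ≤ 2^(2t(b+1)) integer points.  Taking b = 2^z and 2^y to be
-- power-of-two approximations of N^(1/3) and N^(1/d), with t = yd, gives
-- (2t(b+1))^(3d) ≤ (16d)^(3d) N^(d+3), whence 2t(b+1) ≤ M.

module _ {ℓ} {P : Pred ℕ ℓ} (P? : Decidable P) where

  crossing : ∀ {n} → P n → P 0 ⊎ ∃[ m ] ¬ P m × P (suc m)
  crossing {zero}  p0 = inj₁ p0
  crossing {suc n} pn with P? n
  ... | yes pn′ = crossing pn′
  ... | no ¬pn′ = inj₂ (n , ¬pn′ , pn)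

^-distribʳ-* : ∀ m n o → (m * n) ^ o ≡ m ^ o * n ^ o
^-distribʳ-* m n zero    = refl
^-distribʳ-* m n (suc o) = begin
  m * n * (m * n) ^ o     ≡⟨ cong (m * n *_) (^-distribʳ-* m n o) ⟩
  m * n * (m ^ o * n ^ o) ≡⟨ solve 4 (λ m n x y → m :* n :* (x :* y) := m :* x :* (n :* y)) refl m n (m ^ o) (n ^ o) ⟩
  m * m ^ o * (n * n ^ o) ∎
  where open ≡-Reasoning

^-cancelˡ-≤ : ∀ m {a b} → 1 < m → m ^ a ≤ m ^ b → a ≤ b
^-cancelˡ-≤ m 1<m m^a≤m^b = ≮⇒≥ λ b<a → <⇒≱ (^-monoʳ-< m 1<m b<a) m^a≤m^b

^-cancelʳ-≤ : ∀ n .{{_ : NonZero n}} {a b} → a ^ n ≤ b ^ n → a ≤ b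
^-cancelʳ-≤ n a^n≤b^n = ≮⇒≥ λ b<a → <⇒≱ (^-monoˡ-< n b<a) a^n≤b^n

m^[n*o]≡[m^o]^n : ∀ m n o → m ^ (n * o) ≡ (m ^ o) ^ n
m^[n*o]≡[m^o]^n m n o = trans (cong (m ^_) (*-comm n o)) (sym (^-*-assoc m o n))

n<2^n : ∀ n → n < 2 ^ n
n<2^n zero    = s≤s z≤n
n<2^n (suc n) = +-mono-≤ (m^n>0 2 n) (≤-trans (n<2^n n) (m≤m+n (2 ^ n) 0))

valuation : ∀ p m .{{_ : NonZero m}} → 1 < p → ∃[ e ] p ^ e ∣ m × ¬ p ^ suc e ∣ m
valuation p m 1<p with crossing (λ e → ¬? (p ^ e ∣? m)) {m} p^m∤m
  where
  p^m∤m : ¬ p ^ m ∣ m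
  p^m∤m p^m∣m = <⇒≱ (<-≤-trans (n<2^n m) (^-monoˡ-≤ m 1<p)) (∣⇒≤ p^m∣m)
... | inj₁ p^0∤m                  = contradiction (1∣ m) p^0∤m
... | inj₂ (e , ¬p^e∤m , p^1+e∤m) = e , decidable-stable (p ^ e ∣? m) ¬p^e∤m , p^1+e∤m

-- V p m for p < 2 is the junk value 0.
V : ℕ → (m : ℕ) → .{{NonZero m}} → ℕ
V zero          m = 0
V (suc zero)    m = 0
V (suc (suc q)) m = proj₁ (valuation (suc (suc q)) m (s≤s (s≤s z≤n)))

module _ {m : ℕ} .{{_ : NonZero m}} where

  V-∣ : ∀ p → p ^ V p m ∣ m
  V-∣ zero          = 1∣ m
  V-∣ (suc zero)    = 1∣ m
  V-∣ (suc (suc q)) = proj₁ (proj₂ (valuation (suc (suc q)) m (s≤s (s≤s z≤n))))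

  V-∤ : ∀ {p} → Prime p → ¬ p ^ suc (V p m) ∣ m
  V-∤ {zero}        p-prime = contradiction p-prime ¬prime[0]
  V-∤ {suc zero}    p-prime = contradiction p-prime ¬prime[1]
  V-∤ {suc (suc q)} _       = proj₂ (proj₂ (valuation (suc (suc q)) m (s≤s (s≤s z≤n))))

  2^V≤ : ∀ p → 2 ^ V p m ≤ m
  2^V≤ zero          = >-nonZero⁻¹ m
  2^V≤ (suc zero)    = >-nonZero⁻¹ m
  2^V≤ (suc (suc q)) = ≤-trans (^-monoˡ-≤ (V (suc (suc q)) m) (s≤s (s≤s z≤n))) (∣⇒≤ (V-∣ (suc (suc q))))

  V≤ : ∀ {E} p → m ≤ 2 ^ E → V p m ≤ E
  V≤ p m≤2^E = ^-cancelˡ-≤ 2 (s≤s (s≤s z≤n)) (≤-trans (2^V≤ p) m≤2^E)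

length-cartesianProductWith : ∀ {a b c} {A : Set a} {B : Set b} {C : Set c} (f : A → B → C) xs ys →
  length (cartesianProductWith f xs ys) ≡ length xs * length ys
length-cartesianProductWith f []       ys = refl
length-cartesianProductWith f (x ∷ xs) ys = begin
  length (map (f x) ys ++ cartesianProductWith f xs ys)          ≡⟨ length-++ (map (f x) ys) ⟩
  length (map (f x) ys) + length (cartesianProductWith f xs ys)  ≡⟨ cong₂ _+_ (length-map (f x) ys) (length-cartesianProductWith f xs ys) ⟩
  length ys + length xs * length ys                              ∎
  where open ≡-Reasoning

_∷ᶠ_ : ℕ → (ℕ → ℕ) → ℕ → ℕ
(x ∷ᶠ f) zero    = x
(x ∷ᶠ f) (suc p) = f p

truncate : ℕ → (ℕ → ℕ) → ℕ → ℕ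
truncate zero    f = const 0
truncate (suc n) f = f 0 ∷ᶠ truncate n (f ∘ suc)

truncate-< : ∀ {n p} (f : ℕ → ℕ) → p < n → truncate n f p ≡ f p
truncate-< {suc n} {zero}  f _         = refl
truncate-< {suc n} {suc p} f (s≤s p<n) = truncate-< (f ∘ suc) p<n

-- The functions vanishing outside [0, n) with values in [0, E].
boundedFunctions : ℕ → ℕ → List (ℕ → ℕ)
boundedFunctions E zero    = const 0 ∷ []
boundedFunctions E (suc n) = cartesianProductWith _∷ᶠ_ (upTo (suc E)) (boundedFunctions E n)

length-boundedFunctions : ∀ E n → length (boundedFunctions E n) ≡ suc E ^ n
length-boundedFunctions E zero    = refl
length-boundedFunctions E (suc n) = begin
  length (boundedFunctions E (suc n))                  ≡⟨ length-cartesianProductWith _∷ᶠ_ (upTo (suc E)) (boundedFunctions E n) ⟩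
  length (upTo (suc E)) * length (boundedFunctions E n) ≡⟨ cong₂ _*_ (length-upTo (suc E)) (length-boundedFunctions E n) ⟩
  suc E * suc E ^ n                                    ∎
  where open ≡-Reasoning

truncate∈boundedFunctions : ∀ {E} n (f : ℕ → ℕ) → (∀ p → f p ≤ E) → truncate n f ∈ boundedFunctions E n
truncate∈boundedFunctions zero    f f≤E = here refl
truncate∈boundedFunctions (suc n) f f≤E =
  ∈-cartesianProductWith⁺ _∷ᶠ_ (∈-upTo⁺ (s≤s (f≤E 0))) (truncate∈boundedFunctions n (f ∘ suc) (f≤E ∘ suc))

prodSubset-nonZero : ∀ {n} (T : Subset n) → NonZero (prodSubset T)
prodSubset-nonZero {zero}  []          = _
prodSubset-nonZero {suc n} (true  ∷ T) = m*n≢0 (suc n) (prodSubset T) {{_}} {{prodSubset-nonZero T}}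
prodSubset-nonZero {suc n} (false ∷ T) = prodSubset-nonZero T

prodSubset≤n^n : ∀ {n} (T : Subset n) → prodSubset T ≤ n ^ n
prodSubset≤n^n {zero}  []          = ≤-refl
prodSubset≤n^n {suc n} (true  ∷ T) = *-monoʳ-≤ (suc n) (≤-trans (prodSubset≤n^n T) (^-monoˡ-≤ n (n≤1+n n)))
prodSubset≤n^n {suc n} (false ∷ T) =
  ≤-trans (prodSubset≤n^n T) (≤-trans (^-monoˡ-≤ n (n≤1+n n)) (m≤n*m (suc n ^ n) (suc n)))

record ExponentBox (N M : ℕ) : Set where
  field
    primeBound exponentBound : ℕ
    smallPrime<primeBound    : ∀ {p} → SmallPrime N p → p < primeBound
    N^N≤2^exponentBound      : N ^ N ≤ 2 ^ exponentBound
    boxSize≤2^M              : suc exponentBound ^ primeBound ≤ 2 ^ M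

Vsmall∈boundedFunctions : ∀ {N B E} m .{{_ : NonZero m}} → m ≤ 2 ^ E → (∀ {p} → SmallPrime N p → p < B) →
  Σ (ℕ → ℕ) λ v → v ∈ boundedFunctions E B × IsVsmall N m v
Vsmall∈boundedFunctions {N} {B} m m≤2^E small<B =
  truncate B V[_] , truncate∈boundedFunctions B V[_] (λ p → V≤ p m≤2^E) , isVsmall
  where
  V[_] : ℕ → ℕ
  V[ p ] = V p m
  isVsmall : IsVsmall N m (truncate B V[_])
  isVsmall p small rewrite truncate-< V[_] (small<B small) = V-∣ p , V-∤ (proj₁ small)

cover : ∀ {N M} → ExponentBox N M → Σ (List (ℕ → ℕ)) λ L → (length L ≤ 2 ^ M) ×
  ((T : Subset N) → Σ (ℕ → ℕ) λ v → (v ∈ L) × IsVsmall N (prodSubset T) v)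
cover {N} {M} box = boundedFunctions E B , length≤2^M , coverT
  where
  open ExponentBox box renaming (primeBound to B; exponentBound to E)
  length≤2^M : length (boundedFunctions E B) ≤ 2 ^ M
  length≤2^M = ≤-trans (≤-reflexive (length-boundedFunctions E B)) boxSize≤2^M
  coverT : (T : Subset N) → Σ (ℕ → ℕ) λ v → (v ∈ boundedFunctions E B) × IsVsmall N (prodSubset T) v
  coverT T = Vsmall∈boundedFunctions (prodSubset T) {{prodSubset-nonZero T}}
    (≤-trans (prodSubset≤n^n T) N^N≤2^exponentBound) smallPrime<primeBound

powerOfTwoRoot : ∀ d .{{_ : NonZero d}} N .{{_ : NonZero N}} →
  ∃[ y ] N ≤ 2 ^ (y * d) × 2 ^ (y * d) ≤ 2 ^ d * N
powerOfTwoRoot d N with crossing (λ y → N ≤? 2 ^ (y * d)) {N} N≤2^[N*d]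
  where
  N≤2^[N*d] : N ≤ 2 ^ (N * d)
  N≤2^[N*d] = ≤-trans (<⇒≤ (n<2^n N)) (^-monoʳ-≤ 2 (m≤m*n N d))
... | inj₁ N≤1 = 0 , N≤1 , *-mono-≤ (m^n>0 2 d) (>-nonZero⁻¹ N)
... | inj₂ (j , N≰2^[j*d] , N≤2^[d+j*d]) = suc j , N≤2^[d+j*d] , 2^[d+j*d]≤2^d*N
  where
  open ≤-Reasoning
  2^[d+j*d]≤2^d*N : 2 ^ (d + j * d) ≤ 2 ^ d * N
  2^[d+j*d]≤2^d*N = begin
    2 ^ (d + j * d)     ≡⟨ ^-distribˡ-+-* 2 d (j * d) ⟩
    2 ^ d * 2 ^ (j * d) ≤⟨ *-monoʳ-≤ (2 ^ d) (<⇒≤ (≰⇒> N≰2^[j*d])) ⟩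
    2 ^ d * N           ∎

suc[t*N]≤2^[t+t] : ∀ t {N} .{{_ : NonZero N}} → N ≤ 2 ^ t → suc (t * N) ≤ 2 ^ (t + t)
suc[t*N]≤2^[t+t] t {N} N≤2^t = begin
  suc (t * N)    ≤⟨ +-monoˡ-≤ (t * N) (>-nonZero⁻¹ N) ⟩
  suc t * N      ≤⟨ *-mono-≤ (n<2^n t) N≤2^t ⟩
  2 ^ t * 2 ^ t  ≡⟨ ^-distribˡ-+-* 2 t t ⟨
  2 ^ (t + t)    ∎
  where open ≤-Reasoning

[y*d+y*d]^d≤ : ∀ y d {N} → 2 ^ (y * d) ≤ 2 ^ d * N → (y * d + y * d) ^ d ≤ (4 * d) ^ d * N
[y*d+y*d]^d≤ y d {N} 2^[y*d]≤2^d*N = begin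
  (y * d + y * d) ^ d          ≤⟨ ^-monoˡ-≤ d y*d+y*d≤2d*2^y ⟩
  (2 * d * 2 ^ y) ^ d          ≡⟨ ^-distribʳ-* (2 * d) (2 ^ y) d ⟩
  (2 * d) ^ d * (2 ^ y) ^ d    ≡⟨ cong ((2 * d) ^ d *_) (^-*-assoc 2 y d) ⟩
  (2 * d) ^ d * 2 ^ (y * d)    ≤⟨ *-monoʳ-≤ ((2 * d) ^ d) 2^[y*d]≤2^d*N ⟩
  (2 * d) ^ d * (2 ^ d * N)    ≡⟨ *-assoc ((2 * d) ^ d) (2 ^ d) N ⟨
  (2 * d) ^ d * 2 ^ d * N      ≡⟨ cong (_* N) (^-distribʳ-* (2 * d) 2 d) ⟨
  (2 * d * 2) ^ d * N          ≡⟨ cong (λ x → x ^ d * N) (solve 1 (λ d → con 2 :* d :* con 2 := con 4 :* d) refl d) ⟩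
  (4 * d) ^ d * N              ∎
  where
  open ≤-Reasoning
  y*d+y*d≤2d*2^y : y * d + y * d ≤ 2 * d * 2 ^ y
  y*d+y*d≤2d*2^y = ≤-trans (≤-reflexive (solve 2 (λ y d → y :* d :+ y :* d := con 2 :* d :* y) refl y d))
                           (*-monoʳ-≤ (2 * d) (<⇒≤ (n<2^n y)))

suc[2^z]^3≤ : ∀ z {N} → 2 ^ (z * 3) ≤ 8 * N → suc (2 ^ z) ^ 3 ≤ 64 * N
suc[2^z]^3≤ z {N} 2^[z*3]≤8N = begin
  suc (2 ^ z) ^ 3     ≤⟨ ^-monoˡ-≤ 3 (^-monoʳ-< 2 (s≤s (s≤s z≤n)) (n<1+n z)) ⟩
  (2 ^ suc z) ^ 3     ≡⟨ ^-*-assoc 2 (suc z) 3 ⟩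
  2 ^ (3 + z * 3)     ≡⟨ ^-distribˡ-+-* 2 3 (z * 3) ⟩
  8 * 2 ^ (z * 3)     ≤⟨ *-monoʳ-≤ 8 2^[z*3]≤8N ⟩
  8 * (8 * N)         ≡⟨ *-assoc 8 8 N ⟨
  64 * N              ∎
  where open ≤-Reasoning

[x*y]^[3*d]≤ : ∀ d {x y a b N} → x ^ d ≤ a * N → y ^ 3 ≤ b * N →
  (x * y) ^ (3 * d) ≤ a ^ 3 * b ^ d * N ^ (d + 3)
[x*y]^[3*d]≤ d {x} {y} {a} {b} {N} x^d≤aN y^3≤bN = begin
  (x * y) ^ (3 * d)                ≡⟨ ^-distribʳ-* x y (3 * d) ⟩
  x ^ (3 * d) * y ^ (3 * d)        ≡⟨ cong₂ _*_ (m^[n*o]≡[m^o]^n x 3 d) (sym (^-*-assoc y 3 d)) ⟩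
  (x ^ d) ^ 3 * (y ^ 3) ^ d        ≤⟨ *-mono-≤ (^-monoˡ-≤ 3 x^d≤aN) (^-monoˡ-≤ d y^3≤bN) ⟩
  (a * N) ^ 3 * (b * N) ^ d        ≡⟨ cong₂ _*_ (^-distribʳ-* a N 3) (^-distribʳ-* b N d) ⟩
  a ^ 3 * N ^ 3 * (b ^ d * N ^ d)  ≡⟨ solve 4 (λ a n b m → a :* n :* (b :* m) := a :* b :* (m :* n)) refl (a ^ 3) (N ^ 3) (b ^ d) (N ^ d) ⟩
  a ^ 3 * b ^ d * (N ^ d * N ^ 3)  ≡⟨ cong (a ^ 3 * b ^ d *_) (^-distribˡ-+-* N d 3) ⟨
  a ^ 3 * b ^ d * N ^ (d + 3)      ∎
  where open ≤-Reasoning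

[16*d]^[3*d]≡ : ∀ d → (16 * d) ^ (3 * d) ≡ ((4 * d) ^ d) ^ 3 * 64 ^ d
[16*d]^[3*d]≡ d = begin
  (16 * d) ^ (3 * d)               ≡⟨ cong (_^ (3 * d)) (solve 1 (λ d → con 16 :* d := con 4 :* d :* con 4) refl d) ⟩
  (4 * d * 4) ^ (3 * d)            ≡⟨ ^-distribʳ-* (4 * d) 4 (3 * d) ⟩
  (4 * d) ^ (3 * d) * 4 ^ (3 * d)  ≡⟨ cong₂ _*_ (m^[n*o]≡[m^o]^n (4 * d) 3 d) (sym (^-*-assoc 4 3 d)) ⟩
  ((4 * d) ^ d) ^ 3 * 64 ^ d       ∎
  where open ≡-Reasoning

emptyBox : ∀ M → ExponentBox 0 M
emptyBox M = record
  { primeBound            = 0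
  ; exponentBound         = 0
  ; smallPrime<primeBound = λ (p-prime , p^3≤0) → contradiction p^3≤0 (<⇒≱ (m^n>0 _ {{prime⇒nonZero p-prime}} 3))
  ; N^N≤2^exponentBound   = ≤-refl
  ; boxSize≤2^M           = m^n>0 2 M
  }

box : ∀ d .{{_ : NonZero d}} N .{{_ : NonZero N}} M →
  (16 * d) ^ (3 * d) * N ^ (d + 3) ≤ M ^ (3 * d) → ExponentBox N M
box d N M hyp with powerOfTwoRoot d N | powerOfTwoRoot 3 N
... | y , N≤2^t , 2^t≤2^d*N | z , N≤2^[z*3] , 2^[z*3]≤8N = record
  { primeBound            = suc (2 ^ z)
  ; exponentBound         = t * N
  ; smallPrime<primeBound = λ (_ , p^3≤N) →
      s≤s (^-cancelʳ-≤ 3 (≤-trans p^3≤N (≤-trans N≤2^[z*3] (≤-reflexive (sym (^-*-assoc 2 z 3))))))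
  ; N^N≤2^exponentBound   = ≤-trans (^-monoˡ-≤ N N≤2^t) (≤-reflexive (^-*-assoc 2 t N))
  ; boxSize≤2^M           = begin
      suc (t * N) ^ suc (2 ^ z)      ≤⟨ ^-monoˡ-≤ (suc (2 ^ z)) (suc[t*N]≤2^[t+t] t N≤2^t) ⟩
      (2 ^ (t + t)) ^ suc (2 ^ z)    ≡⟨ ^-*-assoc 2 (t + t) (suc (2 ^ z)) ⟩
      2 ^ ((t + t) * suc (2 ^ z))    ≤⟨ ^-monoʳ-≤ 2 [t+t]*B≤M ⟩
      2 ^ M                          ∎
  }
  where
  open ≤-Reasoning
  t = y * d
  [t+t]*B≤M : (t + t) * suc (2 ^ z) ≤ M
  [t+t]*B≤M = ^-cancelʳ-≤ (3 * d) {{m*n≢0 3 d}} (begin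
    ((t + t) * suc (2 ^ z)) ^ (3 * d)             ≤⟨ [x*y]^[3*d]≤ d {a = (4 * d) ^ d} {b = 64} ([y*d+y*d]^d≤ y d 2^t≤2^d*N) (suc[2^z]^3≤ z {N} 2^[z*3]≤8N) ⟩
    ((4 * d) ^ d) ^ 3 * 64 ^ d * N ^ (d + 3)      ≡⟨ cong (_* N ^ (d + 3)) ([16*d]^[3*d]≡ d) ⟨
    (16 * d) ^ (3 * d) * N ^ (d + 3)              ≤⟨ hyp ⟩
    M ^ (3 * d)                                   ∎)

proposition2p1 : (k : ℕ) → Σ ℕ λ C → (N M : ℕ) →
    C * N ^ (suc k + 3) ≤ M ^ (3 * suc k) →
    Σ (List (ℕ → ℕ)) λ L → (length L ≤ 2 ^ M) ×
      ((T : Subset N) → Σ (ℕ → ℕ) λ v → (v ∈ L) × IsVsmall N (prodSubset T) v)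
proposition2p1 k = (16 * suc k) ^ (3 * suc k) , λ where
  zero    M _   → cover (emptyBox M)
  (suc n) M hyp → cover (box (suc k) (suc n) M hyp)
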